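{- Let $\Delta^{hero}$ be the fully heterogeneous dynamic theory over dynamic theories $\Delta^{(0)},\Delta^{(1)}$ (and a set of heterogeneous atoms). For $i\in\{0,1\}$ and every formula $\phi$ over the signature of $\Delta^{(i)}$: if $\phi$ is $\Delta^{(i)}$-valid then $\phi$ is $\Delta^{hero}$-valid. (Equivalently, the rules deriving $\vdash_{\Delta^{hero}}\phi$ from $\vdash_{\Delta^{(i)}}\phi$ for such $\phi$ are sound.)
   Context: A dynamic theory $\Delta$ consists of: pairwise disjoint sets $\mathcal V,\mathcal A,\mathcal P$ (variables, atoms, programs); a nonempty set $U$; a nonempty set $S$ of states with $\mathrm{val}:S\times\mathcal V\to U$ satisfying interpolation (for all $\mu,\nu\in S$, $W\subseteq\mathcal V$ there is $\omega$ agreeing with $\mu$ on $W$ and with $\nu$ outside $W$); $\mathcal E_A:\mathcal A\to2^S$, $\mathrm{FV}_A$ with finite values and states agreeing on $\mathrm{FV}_A(a)$ both in or both out of $\mathcal E_A(a)$; $\mathcal E_P:\mathcal P\to2^{S\times S}$, $\mathrm{FV}_P$ with finite values, overapproximation (for $W\supseteq\mathrm{FV}_P(p)$, $\mu=_W\nu$, $(\mu,\omega)\in\mathcal E_P(p)$ there is $\tilde\omega$ with $(\nu,\tilde\omega)\in\mathcal E_P(p)$, $\omega=_W\tilde\omega$) and extensionality (if $\mu=_{\mathcal V}\nu$ then $(\mu,\omega)\in\mathcal E_P(p)\iff(\nu,\omega)\in\mathcal E_P(p)$); $\mu=_W\nu$ means equal values on all $v\in W$. Formulas $a\mid\neg F\mid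 F\wedge G\mid\forall vF\mid[p]F$ with standard semantics ($[\![\forall vF]\!]$: all $\nu=_{\mathcal V\setminus\{v\}}\mu$ satisfy $F$; $[\![[p]F]\!]$: all $\mathcal E_P(p)$-successors satisfy $F$); valid = true in all states; first-order = no boxes. Havoc lift: add programs $v:=*$ with $\mathcal E(v:=*)=\{(\mu,\nu):\mu=_{\mathcal V\setminus\{v\}}\nu\}$. Regular closure: programs $r\mid p;q\mid p\cup q\mid?(\phi)\mid p^*$ ($\phi$ first-order) with composition, union, $\mathcal E(?(\phi))=\{(\mu,\nu):\mu\in[\![\phi]\!],\mu=_{\mathcal V}\nu\}$, $\mathcal E(p^*)=\bigcup_n\mathcal E(p^n)$. Simple heterogeneous theory over $\Delta^{(0)},\Delta^{(1)}$ and heterogeneous atoms $\mathcal A^c$ (atoms evaluated on $S^{(0)}\times S^{(1)}$ satisfying the atom requirements): variables/atoms/programs are disjoint unions ($\mathcal A^c$ added to the atoms), universe $U^{(0)}\cup U^{(1)}$, states $S^{(0)}\times S^{(1)}$ with $\mathrm{val}((\mu_0,\mu_1),v)=\mathrm{val}^{(i)}(\mu_i,v)$ for $v\in\mathcal V^{(i)}$; atoms of $\mathcal A^{(0)}$ evaluate to $\mathcal E^{(0)}_A(a)\times S^{(1)}$, of $\mathcal A^{(1)}$ to $S^{(0)}\times\mathcal E^{(1)}_A(a)$; programs of $\mathcal P^{(i)}$ act via $\mathcal E^{(i)}_P$ on the $i$-th component, other component unchanged. The fully heterogeneous theory $\Delta^{hero}$ is the regular closure of the havoc lift of the simple heterogeneous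 theory. -}

module Defs where

open import Data.Nat using (ℕ; zero; suc)
open import Data.Product using (Σ; _×_; _,_; proj₁; proj₂)
open import Data.Sum using (_⊎_; inj₁; inj₂)
open import Data.List using (List)
open import Data.List.Membership.Propositional using (_∈_)
open import Relation.Nullary using (¬_)
open import Relation.Binary.PropositionalEquality using (_≡_)

data Fm (V A P : Set) : Set where
  atom : A → Fm V A P
  neg  : Fm V A P → Fm V A P
  conj : Fm V A P → Fm V A P → Fm V A P
  all  : V → Fm V A P → Fm V A P
  box  : P → Fm V A P → Fm V A P

data FirstOrder {V A P : Set} : Fm V A P → Set where
  fo-atom : ∀ a → FirstOrder (atom a)
  fo-neg  : ∀ {F} → FirstOrder F → FirstOrder (neg F)
  fo-conj : ∀ {F G} → FirstOrder F → FirstOrder G → FirstOrder (conj F G)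
  fo-all  : ∀ v {F} → FirstOrder F → FirstOrder (all v F)

mapFm : {V A P V' A' P' : Set} → (V → V') → (A → A') → (P → P') →
        Fm V A P → Fm V' A' P'
mapFm fV fA fP (atom a)   = atom (fA a)
mapFm fV fA fP (neg F)    = neg (mapFm fV fA fP F)
mapFm fV fA fP (conj F G) = conj (mapFm fV fA fP F) (mapFm fV fA fP G)
mapFm fV fA fP (all v F)  = all (fV v) (mapFm fV fA fP F)
mapFm fV fA fP (box p F)  = box (fP p) (mapFm fV fA fP F)

-- Semantic structures (the data of a dynamic theory, without its axioms)

record Structure : Set₁ where
  field
    Var Atm Prg : Set
    U   : Set
    St  : Set
    val : St → Var → U
    EA  : Atm → St → Set
    EP  : Prg → St → St → Set

module _ (Δ : Structure) where
  open Structure Δ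

  AgreeOn : (Var → Set) → St → St → Set
  AgreeOn W μ ν = ∀ v → W v → val μ v ≡ val ν v

  AgreeOnL : List Var → St → St → Set
  AgreeOnL W μ ν = AgreeOn (λ v → v ∈ W) μ ν

  AgreeOff : (Var → Set) → St → St → Set
  AgreeOff W μ ν = AgreeOn (λ v → ¬ W v) μ ν

  AgreeExcept : Var → St → St → Set
  AgreeExcept x = AgreeOff (λ v → v ≡ x)

  AgreeAll : St → St → Set
  AgreeAll μ ν = ∀ v → val μ v ≡ val ν v

  ⟦_⟧ : Fm Var Atm Prg → St → Set
  ⟦ atom a ⟧   μ = EA a μ
  ⟦ neg F ⟧    μ = ¬ ⟦ F ⟧ μ
  ⟦ conj F G ⟧ μ = ⟦ F ⟧ μ × ⟦ G ⟧ μ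
  ⟦ all v F ⟧  μ = ∀ ν → AgreeExcept v ν μ → ⟦ F ⟧ ν
  ⟦ box p F ⟧  μ = ∀ ν → EP p μ ν → ⟦ F ⟧ ν

  Valid : Fm Var Atm Prg → Set
  Valid F = ∀ μ → ⟦ F ⟧ μ

record DynTheory : Set₁ where
  field
    str : Structure
  open Structure str public
  field
    U-nonempty  : U
    St-nonempty : St
    interpolation : ∀ (μ ν : St) (W : Var → Set) →
      Σ St λ ω → AgreeOn str W ω μ × AgreeOff str W ω ν
    FVA : Atm → List Var
    FVA-sound : ∀ a μ ν → AgreeOnL str (FVA a) μ ν →
      (EA a μ → EA a ν) × (EA a ν → EA a μ)
    FVP : Prg → List Var
    overapprox : ∀ p (W : Var → Set) → (∀ v → v ∈ FVP p → W v) →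
      ∀ μ ν ω → AgreeOn str W μ ν → EP p μ ω →
      Σ St λ ω' → EP p ν ω' × AgreeOn str W ω ω'
    extensional : ∀ p μ ν ω → AgreeAll str μ ν →
      (EP p μ ω → EP p ν ω) × (EP p ν ω → EP p μ ω)

-- Havoc lift: add programs v := * (represented by inj₂ v)

havocLift : Structure → Structure
havocLift Δ = record
  { Var = Var ; Atm = Atm ; Prg = Prg ⊎ Var ; U = U ; St = St ; val = val
  ; EA = EA ; EP = ep }
  where
    open Structure Δ
    ep : Prg ⊎ Var → St → St → Set
    ep (inj₁ p) = EP p
    ep (inj₂ v) μ ν = AgreeExcept Δ v μ ν

data RProg (V A P : Set) : Set where
  base  : P → RProg V A P
  seq   : RProg V A P → RProg V A P → RProg V A P
  union : RProg V A P → RProg V A P → RProg V A P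
  test  : (φ : Fm V A P) → FirstOrder φ → RProg V A P
  star  : RProg V A P → RProg V A P

module _ (Δ : Structure) where
  open Structure Δ

  -- n-fold iteration of a relation; R^0 = {(μ,ν) : μ =_V ν} (= ?(true))
  iter : (St → St → Set) → ℕ → St → St → Set
  iter R zero    μ ν = AgreeAll Δ μ ν
  iter R (suc n) μ ν = Σ St λ ω → R μ ω × iter R n ω ν

  regEP : RProg Var Atm Prg → St → St → Set
  regEP (base p)    μ ν = EP p μ ν
  regEP (seq p q)   μ ν = Σ St λ ω → regEP p μ ω × regEP q ω ν
  regEP (union p q) μ ν = regEP p μ ν ⊎ regEP q μ ν
  regEP (test φ _)  μ ν = ⟦ Δ ⟧ φ μ × AgreeAll Δ μ ν
  regEP (star p)    μ ν = Σ ℕ λ n → iter (regEP p) n μ ν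

regClosure : Structure → Structure
regClosure Δ = record
  { Var = Var ; Atm = Atm ; Prg = RProg Var Atm Prg ; U = U ; St = St
  ; val = val ; EA = EA ; EP = regEP Δ }
  where open Structure Δ

record HetAtoms (Δ₀ Δ₁ : DynTheory) : Set₁ where
  module D₀ = DynTheory Δ₀
  module D₁ = DynTheory Δ₁
  field
    Atmᶜ : Set
    EAᶜ  : Atmᶜ → D₀.St × D₁.St → Set
    FVᶜ  : Atmᶜ → List (D₀.Var ⊎ D₁.Var)
  agreeᶜ : (D₀.Var ⊎ D₁.Var → Set) → D₀.St × D₁.St → D₀.St × D₁.St → Set
  agreeᶜ W (μ₀ , μ₁) (ν₀ , ν₁) =
    (∀ v → W (inj₁ v) → D₀.val μ₀ v ≡ D₀.val ν₀ v) ×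
    (∀ v → W (inj₂ v) → D₁.val μ₁ v ≡ D₁.val ν₁ v)
  field
    FVᶜ-sound : ∀ a μ ν → agreeᶜ (λ v → v ∈ FVᶜ a) μ ν →
      (EAᶜ a μ → EAᶜ a ν) × (EAᶜ a ν → EAᶜ a μ)

simpleHet : (Δ₀ Δ₁ : DynTheory) → HetAtoms Δ₀ Δ₁ → Structure
simpleHet Δ₀ Δ₁ H = record
  { Var = D₀.Var ⊎ D₁.Var
  ; Atm = D₀.Atm ⊎ (D₁.Atm ⊎ Atmᶜ)
  ; Prg = D₀.Prg ⊎ D₁.Prg
  ; U   = D₀.U ⊎ D₁.U
  ; St  = D₀.St × D₁.St
  ; val = vl
  ; EA  = ea
  ; EP  = ep }
  where
    module D₀ = DynTheory Δ₀
    module D₁ = DynTheory Δ₁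
    open HetAtoms H using (Atmᶜ; EAᶜ)
    vl : D₀.St × D₁.St → D₀.Var ⊎ D₁.Var → D₀.U ⊎ D₁.U
    vl (μ₀ , μ₁) (inj₁ v) = inj₁ (D₀.val μ₀ v)
    vl (μ₀ , μ₁) (inj₂ v) = inj₂ (D₁.val μ₁ v)
    ea : D₀.Atm ⊎ (D₁.Atm ⊎ Atmᶜ) → D₀.St × D₁.St → Set
    ea (inj₁ a)        (μ₀ , μ₁) = D₀.EA a μ₀
    ea (inj₂ (inj₁ a)) (μ₀ , μ₁) = D₁.EA a μ₁
    ea (inj₂ (inj₂ a)) μ        = EAᶜ a μ
    ep : D₀.Prg ⊎ D₁.Prg → D₀.St × D₁.St → D₀.St × D₁.St → Set
    ep (inj₁ p) (μ₀ , μ₁) (ν₀ , ν₁) = D₀.EP p μ₀ ν₀ × ν₁ ≡ μ₁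
    ep (inj₂ p) (μ₀ , μ₁) (ν₀ , ν₁) = D₁.EP p μ₁ ν₁ × ν₀ ≡ μ₀

hero : (Δ₀ Δ₁ : DynTheory) → HetAtoms Δ₀ Δ₁ → Structure
hero Δ₀ Δ₁ H = regClosure (havocLift (simpleHet Δ₀ Δ₁ H))

module _ (Δ₀ Δ₁ : DynTheory) (H : HetAtoms Δ₀ Δ₁) where
  private
    module D₀ = DynTheory Δ₀
    module D₁ = DynTheory Δ₁
    module Hr = Structure (hero Δ₀ Δ₁ H)

  embed₀ : Fm D₀.Var D₀.Atm D₀.Prg → Fm Hr.Var Hr.Atm Hr.Prg
  embed₀ = mapFm inj₁ inj₁ (λ p → base (inj₁ (inj₁ p)))

  embed₁ : Fm D₁.Var D₁.Atm D₁.Prg → Fm Hr.Var Hr.Atm Hr.Prg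
  embed₁ = mapFm inj₂ (λ a → inj₂ (inj₁ a)) (λ p → base (inj₁ (inj₂ p)))

{-# OPTIONS --safe #-}
-- The projection of a heterogeneous state (μ₀ , μ₁) onto its i-th component
-- is a bounded morphism (p-morphism) from Δ^hero to Δ⁽ⁱ⁾ along the embedding
-- of signatures: atoms of Δ⁽ⁱ⁾ are evaluated through it, and every program or
-- quantifier step of Δ⁽ⁱ⁾ is matched by one in Δ^hero that leaves the other
-- component fixed, and conversely.  Truth of formulas is invariant under
-- bounded morphisms, so validity in Δ⁽ⁱ⁾ transfers to Δ^hero.  None of the
-- axioms of a dynamic theory is needed.
module Submission where

open import Defs
open import Data.Product using (Σ; _×_; _,_; proj₁; proj₂)
open import Data.Product.Function.NonDependent.Propositional using (_×-⇔_)
open import Data.Sum using (inj₁; inj₂)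
open import Data.Sum.Properties using (inj₁-injective; inj₂-injective)
open import Function using (_∘_; flip)
open import Function.Bundles using (_⇔_; mk⇔; module Equivalence)
open import Function.Construct.Identity using (⇔-id)
open import Function.Related.TypeIsomorphisms using (¬-cong-⇔)
open import Relation.Binary.PropositionalEquality using (_≡_; refl; cong)

record Zigzag {S T : Set} (f : S → T) (R : S → S → Set) (R′ : T → T → Set) : Set where
  field
    forth : ∀ {μ ν} → R μ ν → R′ (f μ) (f ν)
    back  : ∀ {μ ν′} → R′ (f μ) ν′ → Σ S λ ν → R μ ν × f ν ≡ ν′

□-cong-zigzag : {S T : Set} {f : S → T} {R : S → S → Set} {R′ : T → T → Set}
                {P : S → Set} {Q : T → Set} →
                Zigzag f R R′ → (∀ ν → P ν ⇔ Q (f ν)) →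
                ∀ μ → (∀ ν → R μ ν → P ν) ⇔ (∀ ν′ → R′ (f μ) ν′ → Q ν′)
□-cong-zigzag {f = f} {R = R} {R′ = R′} {P = P} {Q = Q} zz P⇔Q μ = mk⇔ to from
  where
  open Zigzag zz

  to : (∀ ν → R μ ν → P ν) → ∀ ν′ → R′ (f μ) ν′ → Q ν′
  to □P ν′ μR′ν′ with back μR′ν′
  ... | ν , μRν , refl = Equivalence.to (P⇔Q ν) (□P ν μRν)

  from : (∀ ν′ → R′ (f μ) ν′ → Q ν′) → ∀ ν → R μ ν → P ν
  from □Q ν μRν = Equivalence.from (P⇔Q ν) (□Q (f ν) (forth μRν))

record BoundedMorphism (Δ Δ′ : Structure) : Set where
  module S = Structure Δ
  module T = Structure Δ′
  field
    onSt  : S.St → T.St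
    onVar : T.Var → S.Var
    onAtm : T.Atm → S.Atm
    onPrg : T.Prg → S.Prg
    EA-preserved : ∀ a μ → S.EA (onAtm a) μ ⇔ T.EA a (onSt μ)
    EP-zigzag    : ∀ p → Zigzag onSt (S.EP (onPrg p)) (T.EP p)
    ∀-zigzag     : ∀ v → Zigzag onSt (flip (AgreeExcept Δ (onVar v)))
                                     (flip (AgreeExcept Δ′ v))

  translate : Fm T.Var T.Atm T.Prg → Fm S.Var S.Atm S.Prg
  translate = mapFm onVar onAtm onPrg

  ⟦translate⟧ : ∀ φ μ → ⟦ Δ ⟧ (translate φ) μ ⇔ ⟦ Δ′ ⟧ φ (onSt μ)
  ⟦translate⟧ (atom a)   μ = EA-preserved a μ
  ⟦translate⟧ (neg F)    μ = ¬-cong-⇔ (⟦translate⟧ F μ)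
  ⟦translate⟧ (conj F G) μ = ⟦translate⟧ F μ ×-⇔ ⟦translate⟧ G μ
  ⟦translate⟧ (all v F)  μ = □-cong-zigzag (∀-zigzag v) (⟦translate⟧ F) μ
  ⟦translate⟧ (box p F)  μ = □-cong-zigzag (EP-zigzag p) (⟦translate⟧ F) μ

  translate-valid : ∀ φ → Valid Δ′ φ → Valid Δ (translate φ)
  translate-valid φ valid μ = Equivalence.from (⟦translate⟧ φ μ) (valid (onSt μ))

module _ (Δ₀ Δ₁ : DynTheory) (H : HetAtoms Δ₀ Δ₁) where
  private
    module D₀ = DynTheory Δ₀
    module D₁ = DynTheory Δ₁
    Δʰ = hero Δ₀ Δ₁ H

  proj₁-boundedMorphism : BoundedMorphism Δʰ D₀.str
  proj₁-boundedMorphism = record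
    { onSt  = proj₁
    ; onVar = inj₁
    ; onAtm = inj₁
    ; onPrg = λ p → base (inj₁ (inj₁ p))
    ; EA-preserved = λ _ _ → ⇔-id _
    ; EP-zigzag = λ _ → record
        { forth = proj₁
        ; back  = λ { {_ , μ₁} {ν₀} e → (ν₀ , μ₁) , (e , refl) , refl }
        }
    ; ∀-zigzag = λ _ → record
        { forth = λ ag w w≢v → inj₁-injective (ag (inj₁ w) (w≢v ∘ inj₁-injective))
        ; back  = λ { {_ , μ₁} {ν₀} ag → (ν₀ , μ₁) , lift ag , refl }
        }
    }
    where
    lift : ∀ {v μ₀ ν₀ μ₁} → AgreeExcept D₀.str v ν₀ μ₀ →
           AgreeExcept Δʰ (inj₁ v) (ν₀ , μ₁) (μ₀ , μ₁)
    lift ag (inj₁ w) w≢v = cong inj₁ (ag w (w≢v ∘ cong inj₁))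
    lift ag (inj₂ w) _   = refl

  proj₂-boundedMorphism : BoundedMorphism Δʰ D₁.str
  proj₂-boundedMorphism = record
    { onSt  = proj₂
    ; onVar = inj₂
    ; onAtm = λ a → inj₂ (inj₁ a)
    ; onPrg = λ p → base (inj₁ (inj₂ p))
    ; EA-preserved = λ _ _ → ⇔-id _
    ; EP-zigzag = λ _ → record
        { forth = proj₁
        ; back  = λ { {μ₀ , _} {ν₁} e → (μ₀ , ν₁) , (e , refl) , refl }
        }
    ; ∀-zigzag = λ _ → record
        { forth = λ ag w w≢v → inj₂-injective (ag (inj₂ w) (w≢v ∘ inj₂-injective))
        ; back  = λ { {μ₀ , _} {ν₁} ag → (μ₀ , ν₁) , lift ag , refl }
        }
    }
    where
    lift : ∀ {v μ₁ ν₁ μ₀} → AgreeExcept D₁.str v ν₁ μ₁ →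
           AgreeExcept Δʰ (inj₂ v) (μ₀ , ν₁) (μ₀ , μ₁)
    lift ag (inj₁ w) _   = refl
    lift ag (inj₂ w) w≢v = cong inj₂ (ag w (w≢v ∘ cong inj₂))

mainTheorem14 : (Δ₀ Δ₁ : DynTheory) (H : HetAtoms Δ₀ Δ₁) →
    (∀ (φ : Fm (DynTheory.Var Δ₀) (DynTheory.Atm Δ₀) (DynTheory.Prg Δ₀)) →
       Valid (DynTheory.str Δ₀) φ → Valid (hero Δ₀ Δ₁ H) (embed₀ Δ₀ Δ₁ H φ))
    ×
    (∀ (φ : Fm (DynTheory.Var Δ₁) (DynTheory.Atm Δ₁) (DynTheory.Prg Δ₁)) →
       Valid (DynTheory.str Δ₁) φ → Valid (hero Δ₀ Δ₁ H) (embed₁ Δ₀ Δ₁ H φ))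
mainTheorem14 Δ₀ Δ₁ H =
  BoundedMorphism.translate-valid (proj₁-boundedMorphism Δ₀ Δ₁ H) ,
  BoundedMorphism.translate-valid (proj₂-boundedMorphism Δ₀ Δ₁ H)
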